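{- Let $F$ be a forest with $n$ vertices and independence number $\alpha$. Then \[ mis(F)\geq f(n-\alpha+2), \] and this inequality is sharp: for every integer $n\geq 2$ and every integer $\alpha$ with $\lceil n/2\rceil \le \alpha \le n-1$ there exists a forest with $n$ vertices and independence number $\alpha$ attaining equality.
   Context: All graphs are simple and finite. An independent set of a graph $G$ is a set of pairwise non-adjacent vertices; a maximal independent set is an independent set not properly contained in another independent set. $mis(G)$ denotes the number of maximal independent sets of $G$, and $\alpha(G)$ is the maximum size of an independent set. $f(n)$ denotes the $n$th Fibonacci number: $f(0)=0$, $f(1)=1$, $f(n)=f(n-1)+f(n-2)$ for $n\ge 2$. -}

module Defs where

open import Data.Nat using (ℕ; zero; suc; _+_)
open import Data.Bool using (Bool; true; false)
open import Data.Fin using (Fin; inject₁; fromℕ) renaming (zero to fzero; suc to fsuc)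
open import Data.Fin.Subset using (Subset; _∈_; _∉_; _⊆_; ∣_∣; inside; outside)
open import Data.Fin.Subset.Properties using (_∈?_; _⊆?_; anySubset?)
open import Data.Fin.Properties using (all?)
open import Data.Vec using (_∷_; [])
open import Data.List using (List; [_]; _++_; map; filter; length)
open import Data.Product using (Σ; _×_; _,_; ∃)
open import Function.Definitions using (Injective)
open import Relation.Binary.PropositionalEquality using (_≡_)
open import Relation.Nullary using (Dec; yes; no; ¬_)
open import Relation.Nullary.Decidable using (_×-dec_; _→-dec_; ¬?)
open import Data.Bool.Properties using () renaming (_≟_ to _≟ᵇ_)
open import Data.Nat using (_≤_)

fib : ℕ → ℕ
fib zero = 0
fib (suc zero) = 1
fib (suc (suc n)) = fib (suc n) + fib n

record Graph (n : ℕ) : Set where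
  field
    Adj    : Fin n → Fin n → Bool
    sym    : ∀ u v → Adj u v ≡ Adj v u
    irrefl : ∀ v → Adj v v ≡ false
open Graph public

-- A cycle in G: k = m + 3 ≥ 3 pairwise distinct vertices v₀,…,v_{k-1} with
-- v_i ~ v_{i+1} for all i < k-1 and v_{k-1} ~ v₀.
record Cycle {n : ℕ} (G : Graph n) : Set where
  field
    m        : ℕ
    vs       : Fin (suc (suc (suc m))) → Fin n
    distinct : Injective _≡_ _≡_ vs
    steps    : ∀ (i : Fin (suc (suc m))) → Adj G (vs (inject₁ i)) (vs (fsuc i)) ≡ true
    closing  : Adj G (vs (fromℕ (suc (suc m)))) (vs fzero) ≡ true

Forest : ∀ {n} → Graph n → Set
Forest G = ¬ Cycle G

Independent : ∀ {n} → Graph n → Subset n → Set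
Independent G S = ∀ u v → u ∈ S → v ∈ S → Adj G u v ≡ false

MaximalIndependent : ∀ {n} → Graph n → Subset n → Set
MaximalIndependent G S = Independent G S × (∀ T → Independent G T → S ⊆ T → T ⊆ S)

independent? : ∀ {n} (G : Graph n) (S : Subset n) → Dec (Independent G S)
independent? G S = all? λ u → all? λ v → (u ∈? S) →-dec ((v ∈? S) →-dec (Adj G u v ≟ᵇ false))

maximalIndependent? : ∀ {n} (G : Graph n) (S : Subset n) → Dec (MaximalIndependent G S)
maximalIndependent? G S with independent? G S
... | no ¬i = no λ { (i , _) → ¬i i }
... | yes i with anySubset? (λ T → independent? G T ×-dec ((S ⊆? T) ×-dec ¬? (T ⊆? S)))
...   | yes (T , iT , S⊆T , ¬T⊆S) = no λ { (_ , mx) → ¬T⊆S (mx T iT S⊆T) }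
...   | no ¬ex = yes (i , λ T iT S⊆T → helper T iT S⊆T)
  where
  helper : ∀ T → Independent G T → S ⊆ T → T ⊆ S
  helper T iT S⊆T with T ⊆? S
  ... | yes T⊆S = T⊆S
  ... | no ¬T⊆S = Data.Empty.⊥-elim (¬ex (T , iT , S⊆T , ¬T⊆S))
    where import Data.Empty

-- All subsets of Fin n (each exactly once)
allSubsets : ∀ n → List (Subset n)
allSubsets zero = [ [] ]
allSubsets (suc n) = map (inside ∷_) (allSubsets n) ++ map (outside ∷_) (allSubsets n)

mis : ∀ {n} → Graph n → ℕ
mis G = length (filter (maximalIndependent? G) (allSubsets _))

IsIndependenceNumber : ∀ {n} → Graph n → ℕ → Set
IsIndependenceNumber {n} G a =
  (Σ (Subset n) λ S → Independent G S × ∣ S ∣ ≡ a)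
  × (∀ S → Independent G S → ∣ S ∣ ≤ a)

-- Work with the maximal independent sets of induced subgraphs G[X].  If v is a
-- leaf of G[X] hanging at u, each of them contains exactly one of u and v, so
-- mis(G[X]) = mis(G[X ─ N[v]]) + mis(G[X ─ N[u]]).  In a forest with an edge, the
-- second vertex u of a longest path has at most one neighbour that is not a leaf;
-- adding v, respectively those leaves, to independent sets shows that the gap
-- ∣X∣ − α(G[X]) drops by at most 1, respectively 2, so induction on ∣X∣ gives
-- mis ≥ f(gap + 2).  Equality holds for a comb with n − α teeth plus isolated
-- vertices, where the same identity produces the Fibonacci recurrence.
module Submission where

open import Defs renaming (sym to Adj-sym; irrefl to Adj-irrefl)
open import Level using (Level)
open import Function using (_∘_; id)
open import Induction.WellFounded using (Acc; acc)
open import Data.Empty using (⊥; ⊥-elim)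
open import Data.Bool using (Bool; true; false; _∨_)
open import Data.Bool.Properties using (¬-not; not-¬; ∨-comm; ∨-zeroʳ) renaming (_≟_ to _≟ᵇ_)
open import Data.Nat using (ℕ; zero; suc; pred; _+_; _∸_; _≤_; _<_; z≤n; s≤s; _≤?_; ⌈_/2⌉; ⌊_/2⌋)
open import Data.Nat.Induction using (<-wellFounded)
open import Data.Nat.Properties
  using ( ≤-refl; ≤-trans; ≤-reflexive; ≤-antisym; ≤-pred; ≤-<-trans; <-≤-trans; <-cmp; <-irrefl; <-trans
        ; <⇒≱; <⇒≯; ≤∧≢⇒<; ≰⇒>; m≤n⇒∃[o]m+o≡n; m≤n⇒m≤1+n; m≤m+n; m≤n+m; m≢1+n+m; n≤1+n; n≤0⇒n≡0
        ; +-comm; +-assoc; +-suc; +-identityʳ; +-cancelˡ-≡; +-cancelˡ-≤; +-cancelʳ-<; +-mono-≤; +-monoʳ-≤; +-monoˡ-≤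
        ; +-∸-assoc; m+[n∸m]≡n; m∸n+n≡m; m∸[m∸n]≡n; m+n∸n≡m; m∸n≤m; ∸-monoˡ-≤; ⌊n/2⌋≤⌈n/2⌉; ⌊n/2⌋+⌈n/2⌉≡n
        ; module ≤-Reasoning)
open import Data.Product using (Σ; ∃; ∃₂; _×_; _,_; proj₁; proj₂; ∃-syntax)
open import Data.Sum using (_⊎_; inj₁; inj₂; [_,_]′)
open import Data.Fin using (Fin; toℕ; inject₁; fromℕ; fromℕ<) renaming (zero to fzero; suc to fsuc)
open import Data.Fin.Properties
  using (_≟_; all?; any?; toℕ<n; toℕ-injective; toℕ-inject₁; toℕ-fromℕ; toℕ-fromℕ<; injective⇒≤)
open import Data.Fin.Relation.Unary.Top using (view; ‵fromℕ; ‵inj₁)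
open import Data.Fin.Subset using (Subset; inside; outside; _∈_; _∉_; _⊆_; _∪_; _─_; _-_; ⁅_⁆; ⊤; ∣_∣)
open import Data.Fin.Subset.Properties
  using ( _∈?_; _⊆?_; ∈⊤; ⊆⊤; ⊆-antisym; ∣p∣≤n; ∣⊤∣≡n; ∣⁅x⁆∣≡1; p⊆q⇒∣p∣≤∣q∣; p∩q≢∅⇒∣p─q∣<∣p∣
        ; x∈p∩q⁺; x∈p∪q⁻; x∈p∪q⁺; p─q⊆p; x∈p∧x∉q⇒x∈p─q; x∈p∧x≢y⇒x∈p-y; x∈⁅x⁆; x∈⁅y⁆⇒x≡y; x∉⁅y⁆⇒x≢y)
open import Data.Vec using ([]; _∷_; tabulate; here; there)
open import Data.Vec.Properties using (lookup∘tabulate; lookup⇒[]=; []=⇒lookup)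
open import Data.List using (List; []; _∷_; [_]; map; filter; length; allFin)
open import Data.List.Properties using (length-removeAt′; filter-≐; filter-some)
open import Data.List.Relation.Unary.Any as Any using (here; there; index)
import Data.List.Relation.Unary.All as All
open import Data.List.Relation.Unary.AllPairs using ([]; _∷_)
open import Data.List.Relation.Unary.Unique.Propositional using (Unique)
open import Data.List.Relation.Unary.Unique.Propositional.Properties using (map⁺; ++⁺; filter⁺)
open import Data.List.Membership.Propositional using () renaming (_∈_ to _∈ₗ_)
open import Data.List.Membership.Propositional.Properties
  using (∈-map⁺; ∈-map⁻; ∈-++⁺ˡ; ∈-++⁺ʳ; ∈-filter⁺; ∈-filter⁻; ∈-allFin)
open import Data.List.Extrema.Nat using (argmax; f[xs]≤f[argmax])
open import Relation.Binary using (tri<; tri≈; tri>)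
open import Relation.Nullary using (yes; no; does; ¬_; contradiction)
open import Relation.Nullary.Decidable using (dec-true; map′; decidable-stable; _×-dec_; _⊎-dec_; _→-dec_; ¬?)
open import Relation.Unary using (Pred; Decidable; _≐_)
open import Relation.Unary.Properties using (_∩?_; ∁?)
open import Relation.Binary.PropositionalEquality
  using (_≡_; _≢_; refl; sym; trans; cong; cong₂; subst; subst₂; module ≡-Reasoning)

private variable
  a b ℓ ℓ′ : Level
  n : ℕ
  x : Fin n

select : {P : Pred (Fin n) ℓ} → Decidable P → Subset n
select P? = tabulate (does ∘ P?)

module _ {P : Pred (Fin n) ℓ} (P? : Decidable P) where

  ∈-select⁺ : P x → x ∈ select P?
  ∈-select⁺ {x} px = lookup⇒[]= x _ (trans (lookup∘tabulate (does ∘ P?) x) (dec-true (P? x) px))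

  ∈-select⁻ : x ∈ select P? → P x
  ∈-select⁻ {x} x∈ with P? x | trans (sym (lookup∘tabulate (does ∘ P?) x)) ([]=⇒lookup x∈)
  ... | yes px | _ = px

indicesFrom : ℕ → Subset n
indicesFrom m = select λ x → m ≤? toℕ x

module _ {m : ℕ} where

  ∈indicesFrom⁺ : m ≤ toℕ x → x ∈ indicesFrom m
  ∈indicesFrom⁺ = ∈-select⁺ λ x → m ≤? toℕ x

  ∈indicesFrom⁻ : x ∈ indicesFrom m → m ≤ toℕ x
  ∈indicesFrom⁻ = ∈-select⁻ λ x → m ≤? toℕ x

x∈p─q⇒x∉q : ∀ (p q : Subset n) → x ∈ p ─ q → x ∉ q
x∈p─q⇒x∉q (_ ∷ p) (outside ∷ q) here       ()
x∈p─q⇒x∉q (_ ∷ p) (_       ∷ q) (there x∈) (there x∈q) = x∈p─q⇒x∉q p q x∈ x∈q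

∣p∪q∣≤∣p∣+∣q∣ : ∀ (p q : Subset n) → ∣ p ∪ q ∣ ≤ ∣ p ∣ + ∣ q ∣
∣p∪q∣≤∣p∣+∣q∣ []            []            = z≤n
∣p∪q∣≤∣p∣+∣q∣ (inside  ∷ p) (inside  ∷ q) = s≤s (≤-trans (∣p∪q∣≤∣p∣+∣q∣ p q) (+-monoʳ-≤ ∣ p ∣ (n≤1+n ∣ q ∣)))
∣p∪q∣≤∣p∣+∣q∣ (inside  ∷ p) (outside ∷ q) = s≤s (∣p∪q∣≤∣p∣+∣q∣ p q)
∣p∪q∣≤∣p∣+∣q∣ (outside ∷ p) (inside  ∷ q) = ≤-trans (s≤s (∣p∪q∣≤∣p∣+∣q∣ p q)) (≤-reflexive (sym (+-suc ∣ p ∣ ∣ q ∣)))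
∣p∪q∣≤∣p∣+∣q∣ (outside ∷ p) (outside ∷ q) = ∣p∪q∣≤∣p∣+∣q∣ p q

∣p∪q∣≡∣p∣+∣q∣ : ∀ (p q : Subset n) → (∀ {x} → x ∈ p → x ∉ q) → ∣ p ∪ q ∣ ≡ ∣ p ∣ + ∣ q ∣
∣p∪q∣≡∣p∣+∣q∣ []            []            _    = refl
∣p∪q∣≡∣p∣+∣q∣ (inside  ∷ p) (inside  ∷ q) disj = ⊥-elim (disj here here)
∣p∪q∣≡∣p∣+∣q∣ (inside  ∷ p) (outside ∷ q) disj = cong suc (∣p∪q∣≡∣p∣+∣q∣ p q λ x∈p → disj (there x∈p) ∘ there)
∣p∪q∣≡∣p∣+∣q∣ (outside ∷ p) (inside  ∷ q) disj = trans (cong suc (∣p∪q∣≡∣p∣+∣q∣ p q λ x∈p → disj (there x∈p) ∘ there))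
                                                      (sym (+-suc ∣ p ∣ ∣ q ∣))
∣p∪q∣≡∣p∣+∣q∣ (outside ∷ p) (outside ∷ q) disj = ∣p∪q∣≡∣p∣+∣q∣ p q λ x∈p → disj (there x∈p) ∘ there

p-x∪⁅x⁆≡p : ∀ {p : Subset n} → x ∈ p → (p - x) ∪ ⁅ x ⁆ ≡ p
p-x∪⁅x⁆≡p {x = x} {p} x∈p = ⊆-antisym ⊆p p⊆
  where
  ⊆p : (p - x) ∪ ⁅ x ⁆ ⊆ p
  ⊆p y∈ with x∈p∪q⁻ (p - x) ⁅ x ⁆ y∈
  ... | inj₁ y∈p-x = p─q⊆p p ⁅ x ⁆ y∈p-x
  ... | inj₂ y∈⁅x⁆ rewrite x∈⁅y⁆⇒x≡y x y∈⁅x⁆ = x∈p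
  p⊆ : p ⊆ (p - x) ∪ ⁅ x ⁆
  p⊆ {y} y∈p with y ≟ x
  ... | yes refl = x∈p∪q⁺ (inj₂ (x∈⁅x⁆ x))
  ... | no  y≢x  = x∈p∪q⁺ (inj₁ (x∈p∧x≢y⇒x∈p-y y∈p y≢x))

p∪⁅x⁆-x≡p : ∀ {p : Subset n} → x ∉ p → (p ∪ ⁅ x ⁆) - x ≡ p
p∪⁅x⁆-x≡p {x = x} {p} x∉p = ⊆-antisym ⊆p p⊆
  where
  ⊆p : (p ∪ ⁅ x ⁆) - x ⊆ p
  ⊆p y∈ with x∈p∪q⁻ p ⁅ x ⁆ (p─q⊆p _ ⁅ x ⁆ y∈)
  ... | inj₁ y∈p    = y∈p
  ... | inj₂ y∈⁅x⁆ = contradiction y∈⁅x⁆ (x∈p─q⇒x∉q (p ∪ ⁅ x ⁆) ⁅ x ⁆ y∈)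
  p⊆ : p ⊆ (p ∪ ⁅ x ⁆) - x
  p⊆ y∈p = x∈p∧x≢y⇒x∈p-y (x∈p∪q⁺ (inj₁ y∈p)) λ { refl → x∉p y∈p }

allSubsets-complete : ∀ (S : Subset n) → S ∈ₗ allSubsets n
allSubsets-complete []            = here refl
allSubsets-complete (inside  ∷ S) = ∈-++⁺ˡ (∈-map⁺ (inside ∷_) (allSubsets-complete S))
allSubsets-complete (outside ∷ S) = ∈-++⁺ʳ (map (inside ∷_) (allSubsets _)) (∈-map⁺ (outside ∷_) (allSubsets-complete S))

allSubsets-unique : ∀ n → Unique (allSubsets n)
allSubsets-unique zero    = All.[] ∷ []
allSubsets-unique (suc n) = ++⁺ (map⁺ ∷-injectiveʳ (allSubsets-unique n)) (map⁺ ∷-injectiveʳ (allSubsets-unique n)) disjoint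
  where
  ∷-injectiveʳ : ∀ {s} {S T : Subset n} → s ∷ S ≡ s ∷ T → S ≡ T
  ∷-injectiveʳ refl = refl
  disjoint : ∀ {S} → ¬ (S ∈ₗ map (inside ∷_) (allSubsets n) × S ∈ₗ map (outside ∷_) (allSubsets n))
  disjoint (S∈ , S∈′) with ∈-map⁻ (inside ∷_) S∈ | ∈-map⁻ (outside ∷_) S∈′
  ... | _ , _ , refl | _ , _ , ()

∈-─⁺ : ∀ {A : Set a} {xs : List A} {x y : A} (x∈xs : x ∈ₗ xs) → y ∈ₗ xs → y ≢ x → y ∈ₗ (xs Any.─ x∈xs)
∈-─⁺ (here refl)  (here refl)  y≢x = ⊥-elim (y≢x refl)
∈-─⁺ (here refl)  (there y∈xs) _   = y∈xs
∈-─⁺ (there x∈xs) (here refl)  _   = here refl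
∈-─⁺ (there x∈xs) (there y∈xs) y≢x = there (∈-─⁺ x∈xs y∈xs y≢x)

length-≤-injection : ∀ {A : Set a} {B : Set b} (f : A → B) {xs : List A} {ys : List B} → Unique xs
  → (∀ {x} → x ∈ₗ xs → f x ∈ₗ ys) → (∀ {x y} → x ∈ₗ xs → y ∈ₗ xs → f x ≡ f y → x ≡ y) → length xs ≤ length ys
length-≤-injection f {[]}     _              _    _   = z≤n
length-≤-injection f {x ∷ xs} {ys} (x∉xs ∷ uxs) into inj =
  ≤-trans (s≤s (length-≤-injection f uxs into′ λ x∈ y∈ → inj (there x∈) (there y∈)))
          (≤-reflexive (sym (length-removeAt′ ys (index fx∈ys))))
  where
  fx∈ys = into (here refl)
  into′ : ∀ {y} → y ∈ₗ xs → f y ∈ₗ (ys Any.─ fx∈ys)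
  into′ y∈xs = ∈-─⁺ fx∈ys (into (there y∈xs)) λ fy≡fx →
    All.lookup x∉xs y∈xs (inj (here refl) (there y∈xs) (sym fy≡fx))

count : {P : Pred (Subset n) ℓ} → Decidable P → ℕ
count {n = n} P? = length (filter P? (allSubsets n))

module _ {P : Pred (Subset n) ℓ} (P? : Decidable P) where

  private
    filtered : ∀ {S} → S ∈ₗ filter P? (allSubsets n) → P S
    filtered = proj₂ ∘ ∈-filter⁻ P? {xs = allSubsets n}

  module _ {Q : Pred (Subset n) ℓ′} (Q? : Decidable Q) where

    count-≤ : (f : Subset n → Subset n) → (∀ {S} → P S → Q (f S))
      → (∀ {S T} → P S → P T → f S ≡ f T → S ≡ T) → count P? ≤ count Q?
    count-≤ f PQ inj = length-≤-injection f (filter⁺ P? (allSubsets-unique n))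
      (λ S∈ → ∈-filter⁺ Q? (allSubsets-complete _) (PQ (filtered S∈)))
      (λ S∈ T∈ → inj (filtered S∈) (filtered T∈))

    count-≐ : P ≐ Q → count P? ≡ count Q?
    count-≐ P≐Q = cong length (filter-≐ P? Q? P≐Q (allSubsets n))

    count-partition : count P? ≡ count (P? ∩? Q?) + count (P? ∩? ∁? Q?)
    count-partition = go (allSubsets n)
      where
      go : ∀ Ss → length (filter P? Ss) ≡ length (filter (P? ∩? Q?) Ss) + length (filter (P? ∩? ∁? Q?) Ss)
      go []       = refl
      go (S ∷ Ss) with P? S | Q? S
      ... | yes _ | yes _ = cong suc (go Ss)
      ... | yes _ | no  _ = trans (cong suc (go Ss)) (sym (+-suc _ _))
      ... | no  _ | _     = go Ss

  count-≡1 : ∀ {S₀} → P S₀ → (∀ {S} → P S → S ≡ S₀) → count P? ≡ 1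
  count-≡1 {S₀} PS₀ unique = ≤-antisym
    (length-≤-injection id {ys = [ S₀ ]} (filter⁺ P? (allSubsets-unique n))
      (λ S∈ → here (unique (filtered S∈))) (λ _ _ → id))
    (filter-some P? (Any.map (λ { refl → PS₀ }) (allSubsets-complete S₀)))

count-≡ : {P : Pred (Subset n) ℓ} {Q : Pred (Subset n) ℓ′} (P? : Decidable P) (Q? : Decidable Q)
  (f g : Subset n → Subset n) → (∀ {S} → P S → Q (f S)) → (∀ {T} → Q T → P (g T))
  → (∀ {S} → P S → g (f S) ≡ S) → (∀ {T} → Q T → f (g T) ≡ T) → count P? ≡ count Q?
count-≡ P? Q? f g PQ QP gf fg = ≤-antisym
  (count-≤ P? Q? f PQ λ PS PT e → trans (sym (gf PS)) (trans (cong g e) (gf PT)))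
  (count-≤ Q? P? g QP λ QS QT e → trans (sym (fg QS)) (trans (cong f e) (fg QT)))

Adj-flip : ∀ (G : Graph n) {u v} → Adj G u v ≡ true → Adj G v u ≡ true
Adj-flip G {u} {v} = trans (Adj-sym G v u)

maximum-attained : ∀ {m} (f : Fin (suc m) → ℕ) → ∃ λ t → ∀ s → f s ≤ f t
maximum-attained f = argmax f fzero (allFin _) , λ s → All.lookup (f[xs]≤f[argmax] {f = f} fzero (allFin _)) (∈-allFin s)

cycle-neighbours : ∀ {G : Graph n} (c : Cycle G) t → let open Cycle c in
  ∃₂ λ a b → a ≢ b × Adj G (vs t) (vs a) ≡ true × Adj G (vs t) (vs b) ≡ true
cycle-neighbours {G = G} c fzero = fsuc fzero , fromℕ _ , (λ ()) , Cycle.steps c fzero , Adj-flip G (Cycle.closing c)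
cycle-neighbours {G = G} c (fsuc t) with view t
... | ‵fromℕ          = fzero , inject₁ (fromℕ _) , (λ ()) , Cycle.closing c , Adj-flip G (Cycle.steps c (fromℕ _))
... | ‵inj₁ {i = t} _ =
  inject₁ (inject₁ t) , fsuc (fsuc t) , apart , Adj-flip G (Cycle.steps c (inject₁ t)) , Cycle.steps c (fsuc t)
  where
  apart : inject₁ (inject₁ t) ≢ fsuc (fsuc t)
  apart e = m≢1+n+m (toℕ t) {1} (trans (sym (trans (toℕ-inject₁ (inject₁ t)) (toℕ-inject₁ t))) (cong toℕ e))

-- The highest vertex of a cycle has two distinct lower neighbours on it.
lowerNeighbour-unique⇒forest : ∀ (G : Graph n)
  → (∀ x y y′ → Adj G x y ≡ true → Adj G x y′ ≡ true → toℕ y < toℕ x → toℕ y′ < toℕ x → y ≡ y′) → Forest G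
lowerNeighbour-unique⇒forest G unique c = atTop (maximum-attained (toℕ ∘ vs))
  where
  open Cycle c
  atTop : (∃ λ t → ∀ s → toℕ (vs s) ≤ toℕ (vs t)) → ⊥
  atTop (t , top) = apart (cycle-neighbours c t)
    where
    below : ∀ {a} → Adj G (vs t) (vs a) ≡ true → toℕ (vs a) < toℕ (vs t)
    below {a} t~a = ≤∧≢⇒< (top a) λ e → not-¬ (subst (λ x → Adj G (vs t) x ≡ true) (toℕ-injective e) t~a) (Adj-irrefl G _)
    apart : (∃₂ λ a b → a ≢ b × Adj G (vs t) (vs a) ≡ true × Adj G (vs t) (vs b) ≡ true) → ⊥
    apart (a , b , a≢b , t~a , t~b) = a≢b (distinct (unique (vs t) (vs a) (vs b) t~a t~b (below t~a) (below t~b)))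

-- Maximal independent sets of induced subgraphs

module MaximalIndependentSets (G : Graph n) where

  private
    closedNbr? : ∀ z → Decidable λ x → x ≡ z ⊎ Adj G z x ≡ true
    closedNbr? z x = (x ≟ z) ⊎-dec (Adj G z x ≟ᵇ true)

  N[_] : Fin n → Subset n
  N[ z ] = select (closedNbr? z)

  z∈N[z] : ∀ z → z ∈ N[ z ]
  z∈N[z] z = ∈-select⁺ (closedNbr? z) (inj₁ refl)

  adj⇒∈N[] : ∀ {x z} → Adj G z x ≡ true → x ∈ N[ z ]
  adj⇒∈N[] {z = z} z~x = ∈-select⁺ (closedNbr? z) (inj₂ z~x)

  ∈N[]⇒≡⊎adj : ∀ {x z} → x ∈ N[ z ] → x ≡ z ⊎ Adj G z x ≡ true
  ∈N[]⇒≡⊎adj {z = z} = ∈-select⁻ (closedNbr? z)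

  ∈─N[]⁺ : ∀ {X x z} → x ∈ X → x ≢ z → Adj G z x ≡ false → x ∈ X ─ N[ z ]
  ∈─N[]⁺ x∈X x≢z z≁x = x∈p∧x∉q⇒x∈p─q x∈X λ x∈N → [ x≢z , (λ z~x → not-¬ z~x z≁x) ]′ (∈N[]⇒≡⊎adj x∈N)

  ∈─N[]⁻ : ∀ {X x z} → x ∈ X ─ N[ z ] → x ∈ X × x ≢ z × Adj G z x ≡ false
  ∈─N[]⁻ {X} {x} {z} x∈ = p─q⊆p X N[ z ] x∈ , (λ { refl → x∉N (z∈N[z] x) }) , ¬-not (x∉N ∘ adj⇒∈N[])
    where x∉N = x∈p─q⇒x∉q X N[ z ] x∈

  ∣X─N[z]∣<∣X∣ : ∀ {X z} → z ∈ X → ∣ X ─ N[ z ] ∣ < ∣ X ∣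
  ∣X─N[z]∣<∣X∣ {X} {z} z∈X = p∩q≢∅⇒∣p─q∣<∣p∣ X N[ z ] (z , x∈p∩q⁺ (z∈X , z∈N[z] z))

  indicesFrom-─N[] : ∀ {m} e {z} → (∀ {x} d → d < e → toℕ x ≡ d + m → x ∈ N[ z ])
    → (∀ {x} → e + m ≤ toℕ x → x ∉ N[ z ]) → indicesFrom m ─ N[ z ] ≡ indicesFrom (e + m)
  indicesFrom-─N[] {m} e {z} near far = ⊆-antisym ⊆from ⊇from
    where
    ⊆from : indicesFrom m ─ N[ z ] ⊆ indicesFrom (e + m)
    ⊆from {x} x∈ with e + m ≤? toℕ x
    ... | yes e+m≤x = ∈indicesFrom⁺ e+m≤x
    ... | no  e+m≰x = contradiction (near (toℕ x ∸ m) d<e (sym (m∸n+n≡m m≤x))) (x∈p─q⇒x∉q (indicesFrom m) N[ z ] x∈)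
      where
      m≤x = ∈indicesFrom⁻ {m = m} (p─q⊆p (indicesFrom m) N[ z ] x∈)
      d<e = +-cancelʳ-< m _ e (subst (_< e + m) (sym (m∸n+n≡m m≤x)) (≰⇒> e+m≰x))
    ⊇from : indicesFrom (e + m) ⊆ indicesFrom m ─ N[ z ]
    ⊇from x∈ = let e+m≤x = ∈indicesFrom⁻ x∈ in x∈p∧x∉q⇒x∈p─q (∈indicesFrom⁺ (≤-trans (m≤n+m m e) e+m≤x)) (far e+m≤x)

  Independent-⊆ : ∀ {S T} → S ⊆ T → Independent G T → Independent G S
  Independent-⊆ S⊆T indT u v u∈S v∈S = indT u v (S⊆T u∈S) (S⊆T v∈S)

  Independent-⁅⁆ : ∀ z → Independent G ⁅ z ⁆
  Independent-⁅⁆ z u v u∈ v∈ rewrite x∈⁅y⁆⇒x≡y z u∈ | x∈⁅y⁆⇒x≡y z v∈ = Adj-irrefl G z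

  Independent-∪ : ∀ {S T} → Independent G S → Independent G T → (∀ s t → s ∈ S → t ∈ T → Adj G s t ≡ false)
    → Independent G (S ∪ T)
  Independent-∪ {S} {T} indS indT S≁T u v u∈ v∈ with x∈p∪q⁻ S T u∈ | x∈p∪q⁻ S T v∈
  ... | inj₁ u∈S | inj₁ v∈S = indS u v u∈S v∈S
  ... | inj₁ u∈S | inj₂ v∈T = S≁T u v u∈S v∈T
  ... | inj₂ u∈T | inj₁ v∈S = trans (Adj-sym G u v) (S≁T v u v∈S u∈T)
  ... | inj₂ u∈T | inj₂ v∈T = indT u v u∈T v∈T

  Dominates : Subset n → Subset n → Set
  Dominates S X = ∀ y → y ∈ X → y ∉ S → ∃[ x ] x ∈ S × Adj G x y ≡ true

  record MaximalIndependentIn (X S : Subset n) : Set where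
    field
      ⊆X          : S ⊆ X
      independent : Independent G S
      dominating  : Dominates S X
  open MaximalIndependentIn

  maximalIndependentIn? : ∀ X → Decidable (MaximalIndependentIn X)
  maximalIndependentIn? X S =
    map′ (λ (sid : S ⊆ X × Independent G S × Dominates S X) →
           record { ⊆X = proj₁ sid ; independent = proj₁ (proj₂ sid) ; dominating = proj₂ (proj₂ sid) })
         (λ M → ⊆X M , independent M , dominating M)
         (S ⊆? X ×-dec independent? G S ×-dec dominates?)
    where
    dominates? = all? λ y → y ∈? X →-dec (¬? (y ∈? S) →-dec any? λ x → x ∈? S ×-dec Adj G x y ≟ᵇ true)

  misIn : Subset n → ℕ
  misIn X = count (maximalIndependentIn? X)

  mis≡misIn⊤ : mis G ≡ misIn ⊤
  mis≡misIn⊤ = count-≐ (maximalIndependent? G) (maximalIndependentIn? ⊤) (to , from)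
    where
    to : ∀ {S} → MaximalIndependent G S → MaximalIndependentIn ⊤ S
    to {S} (indS , maximal) = record { ⊆X = ⊆⊤ ; independent = indS ; dominating = dom }
      where
      dom : Dominates S ⊤
      dom y _ y∉S with any? (λ x → x ∈? S ×-dec Adj G x y ≟ᵇ true)
      ... | yes found = found
      ... | no  none  = contradiction (maximal (S ∪ ⁅ y ⁆) indS∪y (x∈p∪q⁺ ∘ inj₁) (x∈p∪q⁺ (inj₂ (x∈⁅x⁆ y)))) y∉S
        where
        indS∪y : Independent G (S ∪ ⁅ y ⁆)
        indS∪y = Independent-∪ indS (Independent-⁅⁆ y) λ s t s∈S t∈⁅y⁆ →
          subst (λ t → Adj G s t ≡ false) (sym (x∈⁅y⁆⇒x≡y y t∈⁅y⁆)) (¬-not λ s~y → none (s , s∈S , s~y))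
    from : ∀ {S} → MaximalIndependentIn ⊤ S → MaximalIndependent G S
    from {S} M = independent M , λ T indT S⊆T {x} x∈T → decidable-stable (x ∈? S) λ x∉S →
      let (s , s∈S , s~x) = dominating M x ∈⊤ x∉S in not-¬ s~x (indT s x (S⊆T s∈S) x∈T)

  misIn-independent : ∀ {X} → Independent G X → misIn X ≡ 1
  misIn-independent {X} indX = count-≡1 (maximalIndependentIn? X) itself onlyItself
    where
    itself : MaximalIndependentIn X X
    itself = record { ⊆X = id ; independent = indX ; dominating = λ y y∈X y∉X → contradiction y∈X y∉X }
    onlyItself : ∀ {S} → MaximalIndependentIn X S → S ≡ X
    onlyItself {S} M = ⊆-antisym (⊆X M) λ {y} y∈X → decidable-stable (y ∈? S) λ y∉S →
      let (x , x∈S , x~y) = dominating M y y∈X y∉S in not-¬ x~y (indX x y (⊆X M x∈S) y∈X)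

  misIn-containing : ∀ {X z} → z ∈ X → count (maximalIndependentIn? X ∩? (z ∈?_)) ≡ misIn (X ─ N[ z ])
  misIn-containing {X} {z} z∈X = count-≡ _ _ (_- z) (_∪ ⁅ z ⁆) remove add
    (λ (_ , z∈S) → p-x∪⁅x⁆≡p z∈S) (λ M → p∪⁅x⁆-x≡p λ z∈T → proj₁ (proj₂ (∈─N[]⁻ (⊆X M z∈T))) refl)
    where
    remove : ∀ {S} → MaximalIndependentIn X S × z ∈ S → MaximalIndependentIn (X ─ N[ z ]) (S - z)
    remove {S} (M , z∈S) = record
      { ⊆X = sub ; independent = Independent-⊆ (p─q⊆p S ⁅ z ⁆) (independent M) ; dominating = dom }
      where
      sub : S - z ⊆ X ─ N[ z ]
      sub {x} x∈ = ∈─N[]⁺ (⊆X M x∈S) (x∉⁅y⁆⇒x≢y (x∈p─q⇒x∉q S ⁅ z ⁆ x∈)) (independent M z x z∈S x∈S)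
        where x∈S = p─q⊆p S ⁅ z ⁆ x∈
      dom : Dominates (S - z) (X ─ N[ z ])
      dom y y∈ y∉S-z with ∈─N[]⁻ y∈
      ... | y∈X , y≢z , z≁y with dominating M y y∈X (λ y∈S → y∉S-z (x∈p∧x≢y⇒x∈p-y y∈S y≢z))
      ...   | x , x∈S , x~y = x , x∈p∧x≢y⇒x∈p-y x∈S (λ { refl → not-¬ x~y z≁y }) , x~y
    add : ∀ {T} → MaximalIndependentIn (X ─ N[ z ]) T → MaximalIndependentIn X (T ∪ ⁅ z ⁆) × z ∈ T ∪ ⁅ z ⁆
    add {T} M = record { ⊆X = sub ; independent = ind ; dominating = dom } , x∈p∪q⁺ (inj₂ (x∈⁅x⁆ z))
      where
      sub : T ∪ ⁅ z ⁆ ⊆ X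
      sub x∈ with x∈p∪q⁻ T ⁅ z ⁆ x∈
      ... | inj₁ x∈T   = proj₁ (∈─N[]⁻ (⊆X M x∈T))
      ... | inj₂ x∈⁅z⁆ rewrite x∈⁅y⁆⇒x≡y z x∈⁅z⁆ = z∈X
      ind : Independent G (T ∪ ⁅ z ⁆)
      ind = Independent-∪ (independent M) (Independent-⁅⁆ z) λ t z′ t∈T z′∈ → begin
        Adj G t z′ ≡⟨ cong (Adj G t) (x∈⁅y⁆⇒x≡y z z′∈) ⟩
        Adj G t z  ≡⟨ Adj-sym G t z ⟩
        Adj G z t  ≡⟨ proj₂ (proj₂ (∈─N[]⁻ (⊆X M t∈T))) ⟩
        false      ∎
        where open ≡-Reasoning
      dom : Dominates (T ∪ ⁅ z ⁆) X
      dom y y∈X y∉ with Adj G z y in z~y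
      ... | true  = z , x∈p∪q⁺ (inj₂ (x∈⁅x⁆ z)) , z~y
      ... | false with dominating M y (∈─N[]⁺ y∈X (λ { refl → y∉ (x∈p∪q⁺ (inj₂ (x∈⁅x⁆ z))) }) z~y) (y∉ ∘ x∈p∪q⁺ ∘ inj₁)
      ...   | x , x∈T , x~y = x , x∈p∪q⁺ (inj₁ x∈T) , x~y

  LeafIn : Subset n → Fin n → Fin n → Set
  LeafIn X v u = ∀ y → y ∈ X → Adj G v y ≡ true → y ≡ u

  -- Every maximal independent set of G[X] contains exactly one of u and v.
  misIn-leaf : ∀ {X u v} → u ∈ X → v ∈ X → Adj G u v ≡ true → LeafIn X v u
    → misIn X ≡ misIn (X ─ N[ v ]) + misIn (X ─ N[ u ])
  misIn-leaf {X} {u} {v} u∈X v∈X u~v leaf = begin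
    misIn X                                             ≡⟨ count-partition MI? (v ∈?_) ⟩
    count (MI? ∩? (v ∈?_)) + count (MI? ∩? ∁? (v ∈?_))
      ≡⟨ cong (count (MI? ∩? (v ∈?_)) +_)
              (count-≐ (MI? ∩? ∁? (v ∈?_)) (MI? ∩? (u ∈?_)) (omits-v⇒has-u , has-u⇒omits-v)) ⟩
    count (MI? ∩? (v ∈?_)) + count (MI? ∩? (u ∈?_))     ≡⟨ cong₂ _+_ (misIn-containing v∈X) (misIn-containing u∈X) ⟩
    misIn (X ─ N[ v ]) + misIn (X ─ N[ u ])             ∎
    where
    open ≡-Reasoning
    MI? = maximalIndependentIn? X
    omits-v⇒has-u : ∀ {S} → MaximalIndependentIn X S × v ∉ S → MaximalIndependentIn X S × u ∈ S
    omits-v⇒has-u (M , v∉S) with dominating M v v∈X v∉S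
    ... | x , x∈S , x~v = M , subst (_∈ _) (leaf x (⊆X M x∈S) (Adj-flip G x~v)) x∈S
    has-u⇒omits-v : ∀ {S} → MaximalIndependentIn X S × u ∈ S → MaximalIndependentIn X S × v ∉ S
    has-u⇒omits-v (M , u∈S) = M , λ v∈S → not-¬ u~v (independent M u v u∈S v∈S)

  misIn-isolated : ∀ {X z} → z ∈ X → (∀ y → y ∈ X → Adj G z y ≡ false) → misIn X ≡ misIn (X ─ N[ z ])
  misIn-isolated {X} {z} z∈X isolated =
    trans (count-≐ (maximalIndependentIn? X) (maximalIndependentIn? X ∩? (z ∈?_)) ((λ M → M , has-z M) , proj₁))
          (misIn-containing z∈X)
    where
    has-z : ∀ {S} → MaximalIndependentIn X S → z ∈ S
    has-z {S} M = decidable-stable (z ∈? S) λ z∉S →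
      let (x , x∈S , x~z) = dominating M z z∈X z∉S in not-¬ (Adj-flip G x~z) (isolated x (⊆X M x∈S))

-- The independence gap

m≤o⇒m+n≤o+p⇒m+[n∸p]≤o : ∀ {m n o p} → m ≤ o → m + n ≤ o + p → m + (n ∸ p) ≤ o
m≤o⇒m+n≤o+p⇒m+[n∸p]≤o {m} {zero}  {o} {zero}  m≤o _  = subst (_≤ o) (sym (+-identityʳ m)) m≤o
m≤o⇒m+n≤o+p⇒m+[n∸p]≤o {m} {zero}  {o} {suc _} m≤o _  = subst (_≤ o) (sym (+-identityʳ m)) m≤o
m≤o⇒m+n≤o+p⇒m+[n∸p]≤o {m} {suc n} {o} {zero}  _   le = subst (m + suc n ≤_) (+-identityʳ o) le
m≤o⇒m+n≤o+p⇒m+[n∸p]≤o {m} {suc n} {o} {suc p} m≤o le =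
  m≤o⇒m+n≤o+p⇒m+[n∸p]≤o m≤o (≤-pred (subst₂ _≤_ (+-suc m n) (+-suc o p) le))

module IndependenceGaps (G : Graph n) where

  open MaximalIndependentSets G

  -- k ≤ ∣ X ∣ − α(G[X]), stated without truncated subtraction
  IndependenceGap≥ : Subset n → ℕ → Set
  IndependenceGap≥ X k = ∀ S → S ⊆ X → Independent G S → ∣ S ∣ + k ≤ ∣ X ∣

  -- An independent L ⊆ X that sees nothing of Y can be added to every independent S ⊆ Y.
  IndependenceGap≥-restrict : ∀ {X Y L C k c} → IndependenceGap≥ X k → Y ⊆ X → L ⊆ X → Independent G L
    → (∀ l y → l ∈ L → y ∈ Y → Adj G l y ≡ false) → (∀ {x} → x ∈ L → x ∉ Y) → X ⊆ (L ∪ Y) ∪ C → ∣ C ∣ ≤ c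
    → IndependenceGap≥ Y (k ∸ c)
  IndependenceGap≥-restrict {X} {Y} {L} {C} {k} {c} gap Y⊆X L⊆X indL L≁Y L∩Y≡∅ cover ∣C∣≤c S S⊆Y indS =
    m≤o⇒m+n≤o+p⇒m+[n∸p]≤o (p⊆q⇒∣p∣≤∣q∣ S⊆Y) (+-cancelˡ-≤ ∣ L ∣ _ _ (begin
      ∣ L ∣ + (∣ S ∣ + k)  ≡⟨ +-assoc ∣ L ∣ ∣ S ∣ k ⟨
      ∣ L ∣ + ∣ S ∣ + k    ≡⟨ cong (_+ k) (∣p∪q∣≡∣p∣+∣q∣ L S λ x∈L x∈S → L∩Y≡∅ x∈L (S⊆Y x∈S)) ⟨
      ∣ L ∪ S ∣ + k        ≤⟨ gap (L ∪ S) L∪S⊆X (Independent-∪ indL indS λ l s l∈L s∈S → L≁Y l s l∈L (S⊆Y s∈S)) ⟩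
      ∣ X ∣                ≤⟨ p⊆q⇒∣p∣≤∣q∣ cover ⟩
      ∣ (L ∪ Y) ∪ C ∣      ≤⟨ ∣p∪q∣≤∣p∣+∣q∣ (L ∪ Y) C ⟩
      ∣ L ∪ Y ∣ + ∣ C ∣    ≤⟨ +-mono-≤ (∣p∪q∣≤∣p∣+∣q∣ L Y) ∣C∣≤c ⟩
      ∣ L ∣ + ∣ Y ∣ + c    ≡⟨ +-assoc ∣ L ∣ ∣ Y ∣ c ⟩
      ∣ L ∣ + (∣ Y ∣ + c)  ∎))
    where
    open ≤-Reasoning
    L∪S⊆X : L ∪ S ⊆ X
    L∪S⊆X x∈ = [ L⊆X , Y⊆X ∘ S⊆Y ]′ (x∈p∪q⁻ L S x∈)

  record EndSupport (X : Subset n) : Set where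
    field
      u v w           : Fin n
      u∈X             : u ∈ X
      v∈X             : v ∈ X
      u~v             : Adj G u v ≡ true
      leaf            : LeafIn X v u
      almostAllLeaves : ∀ x → x ∈ X → Adj G u x ≡ true → x ≢ w → LeafIn X x u

  module _ {X} (es : EndSupport X) where

    open EndSupport es

    IndependenceGap≥-─N[leaf] : ∀ {k} → IndependenceGap≥ X k → IndependenceGap≥ (X ─ N[ v ]) (k ∸ 1)
    IndependenceGap≥-─N[leaf] gap = IndependenceGap≥-restrict gap (p─q⊆p X N[ v ]) ⁅v⁆⊆X (Independent-⁅⁆ v)
      (λ l y l∈ y∈ → subst (λ l → Adj G l y ≡ false) (sym (x∈⁅y⁆⇒x≡y v l∈)) (proj₂ (proj₂ (∈─N[]⁻ y∈))))
      (λ l∈ l∈Y → proj₁ (proj₂ (∈─N[]⁻ l∈Y)) (x∈⁅y⁆⇒x≡y v l∈))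
      cover (≤-reflexive (∣⁅x⁆∣≡1 u))
      where
      ⁅v⁆⊆X : ⁅ v ⁆ ⊆ X
      ⁅v⁆⊆X x∈ rewrite x∈⁅y⁆⇒x≡y v x∈ = v∈X
      cover : X ⊆ (⁅ v ⁆ ∪ (X ─ N[ v ])) ∪ ⁅ u ⁆
      cover {x} x∈X with x ∈? N[ v ]
      ... | no  x∉N = x∈p∪q⁺ (inj₁ (x∈p∪q⁺ (inj₂ (x∈p∧x∉q⇒x∈p─q x∈X x∉N))))
      ... | yes x∈N with ∈N[]⇒≡⊎adj x∈N
      ...   | inj₁ refl = x∈p∪q⁺ (inj₁ (x∈p∪q⁺ (inj₁ (x∈⁅x⁆ v))))
      ...   | inj₂ v~x rewrite leaf x x∈X v~x = x∈p∪q⁺ (inj₂ (x∈⁅x⁆ u))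

    IndependenceGap≥-─N[support] : ∀ {k} → IndependenceGap≥ X k → IndependenceGap≥ (X ─ N[ u ]) (k ∸ 2)
    IndependenceGap≥-─N[support] gap = IndependenceGap≥-restrict gap (p─q⊆p X N[ u ]) (proj₁ ∘ ∈L⁻) indL
      (λ l y l∈L y∈ → ¬-not λ l~y → proj₁ (proj₂ (∈─N[]⁻ y∈)) (isLeaf l∈L y (proj₁ (∈─N[]⁻ y∈)) l~y))
      (λ l∈L l∈Y → not-¬ (proj₁ (proj₂ (∈L⁻ l∈L))) (proj₂ (proj₂ (∈─N[]⁻ l∈Y))))
      cover (≤-trans (∣p∪q∣≤∣p∣+∣q∣ ⁅ u ⁆ ⁅ w ⁆) (≤-reflexive (cong₂ _+_ (∣⁅x⁆∣≡1 u) (∣⁅x⁆∣≡1 w))))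
      where
      leaves? : Decidable λ x → x ∈ X × Adj G u x ≡ true × x ≢ w
      leaves? x = x ∈? X ×-dec Adj G u x ≟ᵇ true ×-dec ¬? (x ≟ w)
      L = select leaves?
      ∈L⁻ = ∈-select⁻ leaves?
      isLeaf : ∀ {l} → l ∈ L → LeafIn X l u
      isLeaf l∈L = let (l∈X , u~l , l≢w) = ∈L⁻ l∈L in almostAllLeaves _ l∈X u~l l≢w
      indL : Independent G L
      indL l l′ l∈L l′∈L = ¬-not λ l~l′ →
        not-¬ (subst (λ x → Adj G u x ≡ true) (isLeaf l∈L l′ (proj₁ (∈L⁻ l′∈L)) l~l′) (proj₁ (proj₂ (∈L⁻ l′∈L))))
              (Adj-irrefl G u)
      cover : X ⊆ (L ∪ (X ─ N[ u ])) ∪ (⁅ u ⁆ ∪ ⁅ w ⁆)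
      cover {x} x∈X with x ∈? N[ u ]
      ... | no  x∉N = x∈p∪q⁺ (inj₁ (x∈p∪q⁺ (inj₂ (x∈p∧x∉q⇒x∈p─q x∈X x∉N))))
      ... | yes x∈N with ∈N[]⇒≡⊎adj x∈N
      ...   | inj₁ refl = x∈p∪q⁺ (inj₂ (x∈p∪q⁺ (inj₁ (x∈⁅x⁆ u))))
      ...   | inj₂ u~x with x ≟ w
      ...     | yes refl = x∈p∪q⁺ (inj₂ (x∈p∪q⁺ (inj₂ (x∈⁅x⁆ w))))
      ...     | no  x≢w  = x∈p∪q⁺ (inj₁ (x∈p∪q⁺ (inj₁ (∈-select⁺ leaves? (x∈X , u~x , x≢w)))))

-- End supports in forests

module EndSupportSearch (G : Graph n) (forest : Forest G) (X : Subset n) where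

  open MaximalIndependentSets G
  open IndependenceGaps G

  -- vertex i is only meaningful for i < L
  record Path (L : ℕ) : Set where
    field
      vertex   : ℕ → Fin n
      inX      : ∀ {i} → i < L → vertex i ∈ X
      distinct : ∀ {i j} → i < L → j < L → vertex i ≡ vertex j → i ≡ j
      step     : ∀ {i} → suc i < L → Adj G (vertex i) (vertex (suc i)) ≡ true

  module _ {L} (R : Path L) where

    open Path R

    Path-length≤ : L ≤ n
    Path-length≤ = injective⇒≤ {f = λ (i : Fin L) → vertex (toℕ i)} λ e → toℕ-injective (distinct (toℕ<n _) (toℕ<n _) e)

    private
      noLongChord : ∀ i m → i + suc (suc m) < L → Adj G (vertex (i + suc (suc m))) (vertex i) ≡ true → ⊥
      noLongChord i m bound chord = forest record { m = m ; vs = vs ; distinct = vs-injective ; steps = steps ; closing = closing }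
        where
        vs : Fin (3 + m) → Fin n
        vs t = vertex (i + toℕ t)
        onPath : ∀ t → i + toℕ t < L
        onPath t = ≤-<-trans (+-monoʳ-≤ i (≤-pred (toℕ<n t))) bound
        vs-injective : ∀ {s t} → vs s ≡ vs t → s ≡ t
        vs-injective e = toℕ-injective (+-cancelˡ-≡ i _ _ (distinct (onPath _) (onPath _) e))
        steps : ∀ t → Adj G (vs (inject₁ t)) (vs (fsuc t)) ≡ true
        steps t rewrite toℕ-inject₁ t | +-suc i (toℕ t) = step (subst (_< L) (+-suc i (toℕ t)) (onPath (fsuc t)))
        closing : Adj G (vs (fromℕ (2 + m))) (vs fzero) ≡ true
        closing rewrite toℕ-fromℕ (2 + m) | +-identityʳ i = chord

      adjacent-forward : ∀ {i j} → i < j → j < L → Adj G (vertex j) (vertex i) ≡ true → j ≡ suc i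
      adjacent-forward {i} i<j j<L j~i with m≤n⇒∃[o]m+o≡n i<j
      ... | zero  , refl = +-identityʳ (suc i)
      ... | suc m , refl = ⊥-elim (noLongChord i m (subst (_< L) i+m+2≡j j<L)
                                                    (subst (λ t → Adj G (vertex t) (vertex i) ≡ true) i+m+2≡j j~i))
        where i+m+2≡j = sym (+-suc i (suc m))

    adjacent⇒consecutive : ∀ {i j} → i < L → j < L → Adj G (vertex i) (vertex j) ≡ true → j ≡ suc i ⊎ i ≡ suc j
    adjacent⇒consecutive {i} {j} i<L j<L i~j with <-cmp i j
    ... | tri< i<j _ _  = inj₁ (adjacent-forward i<j j<L (Adj-flip G i~j))
    ... | tri≈ _ refl _ = ⊥-elim (not-¬ i~j (Adj-irrefl G _))
    ... | tri> _ _ j<i  = inj₂ (adjacent-forward j<i i<L i~j)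

    fresh : ∀ {y} → Adj G (vertex 0) y ≡ true → y ≢ vertex 1 → ∀ {j} → j < L → vertex j ≢ y
    fresh v₀~y y≢v₁ {j} j<L refl with adjacent⇒consecutive (≤-trans (s≤s z≤n) j<L) j<L v₀~y
    ... | inj₁ refl = y≢v₁ refl

  open Path

  tail : ∀ {L} → Path (suc L) → Path L
  tail R = record
    { vertex   = vertex R ∘ suc
    ; inX      = inX R ∘ s≤s
    ; distinct = λ i< j< e → cong pred (distinct R (s≤s i<) (s≤s j<) e)
    ; step     = step R ∘ s≤s
    }

  cons : ∀ {L y} (R : Path L) → y ∈ X → Adj G y (vertex R 0) ≡ true → (∀ {j} → j < L → vertex R j ≢ y) → Path (suc L)
  cons {L} {y} R y∈X y~v₀ new = record { vertex = vertex′ ; inX = inX′ ; distinct = distinct′ ; step = step′ }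
    where
    vertex′ : ℕ → Fin n
    vertex′ zero    = y
    vertex′ (suc i) = vertex R i
    inX′ : ∀ {i} → i < suc L → vertex′ i ∈ X
    inX′ {zero}  _         = y∈X
    inX′ {suc i} (s≤s i<L) = inX R i<L
    distinct′ : ∀ {i j} → i < suc L → j < suc L → vertex′ i ≡ vertex′ j → i ≡ j
    distinct′ {zero}  {zero}  _         _         _ = refl
    distinct′ {zero}  {suc j} _         (s≤s j<L) e = ⊥-elim (new j<L (sym e))
    distinct′ {suc i} {zero}  (s≤s i<L) _         e = ⊥-elim (new i<L e)
    distinct′ {suc i} {suc j} (s≤s i<L) (s≤s j<L) e = cong suc (distinct R i<L j<L e)
    step′ : ∀ {i} → suc i < suc L → Adj G (vertex′ i) (vertex′ (suc i)) ≡ true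
    step′ {zero}  _           = y~v₀
    step′ {suc i} (s≤s i+1<L) = step R i+1<L

  edge-path : ∀ {a b} → a ∈ X → b ∈ X → Adj G a b ≡ true → Path 2
  edge-path {a} {b} a∈X b∈X a~b = record { vertex = vertex′ ; inX = inX′ ; distinct = distinct′ ; step = step′ }
    where
    vertex′ : ℕ → Fin n
    vertex′ zero    = a
    vertex′ (suc _) = b
    inX′ : ∀ {i} → i < 2 → vertex′ i ∈ X
    inX′ {zero}  _ = a∈X
    inX′ {suc _} _ = b∈X
    a≢b : a ≢ b
    a≢b refl = not-¬ a~b (Adj-irrefl G a)
    distinct′ : ∀ {i j} → i < 2 → j < 2 → vertex′ i ≡ vertex′ j → i ≡ j
    distinct′ {zero}       {zero}        _ _ _ = refl
    distinct′ {zero}       {suc _}       _ _ e = ⊥-elim (a≢b e)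
    distinct′ {suc _}      {zero}        _ _ e = ⊥-elim (a≢b (sym e))
    distinct′ {suc zero}   {suc zero}    _ _ _ = refl
    distinct′ {suc (suc _)} (s≤s (s≤s ()))
    distinct′ {suc zero}   {suc (suc _)} _ (s≤s (s≤s ()))
    step′ : ∀ {i} → suc i < 2 → Adj G (vertex′ i) (vertex′ (suc i)) ≡ true
    step′ {zero}  _ = a~b
    step′ {suc _} (s≤s (s≤s ()))

  Escape : Fin n → Fin n → Fin n → Set
  Escape v u y = y ∈ X × Adj G v y ≡ true × y ≢ u

  escape? : ∀ v u → Decidable (Escape v u)
  escape? v u y = y ∈? X ×-dec Adj G v y ≟ᵇ true ×-dec ¬? (y ≟ u)

  leafIn-or-escape : ∀ v u → LeafIn X v u ⊎ ∃[ y ] Escape v u y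
  leafIn-or-escape v u with any? (escape? v u)
  ... | yes escape = inj₂ escape
  ... | no  none   = inj₁ λ y y∈X v~y → decidable-stable (y ≟ u) λ y≢u → none (y , y∈X , v~y , y≢u)

  -- Either the path v₀ v₁ v₂ … ends in an end support (u, v, w) = (v₁, v₀, v₂), or some
  -- neighbour of v₀, or of a neighbour x ≢ v₂ of v₁, extends it to a longer path.
  grow : ∀ {L} → Path (suc (suc L)) → EndSupport X ⊎ Path (suc (suc (suc L)))
  grow R with leafIn-or-escape (vertex R 0) (vertex R 1)
  ... | inj₂ (y , y∈X , v₀~y , y≢v₁) = inj₂ (cons R y∈X (Adj-flip G v₀~y) (fresh R v₀~y y≢v₁))
  ... | inj₁ v₀-leaf
    with any? (λ x → (x ∈? X ×-dec Adj G (vertex R 1) x ≟ᵇ true ×-dec ¬? (x ≟ vertex R 2)) ×-dec any? (escape? x (vertex R 1)))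
  ...   | yes (x , (x∈X , v₁~x , x≢v₂) , y , y∈X , x~y , y≢v₁) =
    let R′ = cons (tail R) x∈X (Adj-flip G v₁~x) (fresh (tail R) v₁~x x≢v₂)
    in inj₂ (cons R′ y∈X (Adj-flip G x~y) (fresh R′ x~y y≢v₁))
  ...   | no  none = inj₁ record
    { u = vertex R 1 ; v = vertex R 0 ; w = vertex R 2
    ; u∈X = inX R (s≤s (s≤s z≤n)) ; v∈X = inX R (s≤s z≤n) ; u~v = Adj-flip G (step R (s≤s (s≤s z≤n)))
    ; leaf = v₀-leaf
    ; almostAllLeaves = λ x x∈X v₁~x x≢v₂ →
        [ id , (λ escape → ⊥-elim (none (x , (x∈X , v₁~x , x≢v₂) , escape))) ]′ (leafIn-or-escape x (vertex R 1))
    }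

  -- Paths have at most n vertices, so fuel n suffices.
  search : ∀ fuel {L} → n < suc (suc L) + fuel → Path (suc (suc L)) → EndSupport X
  search zero             n<L R = ⊥-elim (<⇒≱ (subst (n <_) (+-identityʳ _) n<L) (Path-length≤ R))
  search (suc fuel) {L} n<    R with grow R
  ... | inj₁ es = es
  ... | inj₂ R′ = search fuel (subst (n <_) (+-suc (suc (suc L)) fuel) n<) R′

  independent-or-endSupport : Independent G X ⊎ EndSupport X
  independent-or-endSupport with any? (λ a → any? λ b → a ∈? X ×-dec b ∈? X ×-dec Adj G a b ≟ᵇ true)
  ... | yes (a , b , a∈X , b∈X , a~b) = inj₂ (search n (s≤s (n≤1+n n)) (edge-path a∈X b∈X a~b))
  ... | no  none = inj₁ λ a b a∈X b∈X → ¬-not λ a~b → none (a , b , a∈X , b∈X , a~b)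

-- The lower bound

fib[2+k]≤fib[2+k∸1]+fib[2+k∸2] : ∀ k → fib (2 + k) ≤ fib (2 + (k ∸ 1)) + fib (2 + (k ∸ 2))
fib[2+k]≤fib[2+k∸1]+fib[2+k∸2] zero          = s≤s z≤n
fib[2+k]≤fib[2+k∸1]+fib[2+k∸2] (suc zero)    = ≤-refl
fib[2+k]≤fib[2+k∸1]+fib[2+k∸2] (suc (suc k)) = ≤-refl

module LowerBound (G : Graph n) (forest : Forest G) where

  open MaximalIndependentSets G
  open IndependenceGaps G
  open ≤-Reasoning

  fib-≤-misIn : ∀ X k → IndependenceGap≥ X k → fib (2 + k) ≤ misIn X
  fib-≤-misIn X k gap = go X k gap (<-wellFounded ∣ X ∣)
    where
    go : ∀ X k → IndependenceGap≥ X k → Acc _<_ ∣ X ∣ → fib (2 + k) ≤ misIn X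
    go X k gap (acc smaller) with EndSupportSearch.independent-or-endSupport G forest X
    ... | inj₁ indX = begin
      fib (2 + k) ≡⟨ cong (λ k → fib (2 + k)) k≡0 ⟩
      1           ≡⟨ misIn-independent indX ⟨
      misIn X     ∎
      where
      k≡0 = n≤0⇒n≡0 (+-cancelˡ-≤ ∣ X ∣ k 0 (subst (∣ X ∣ + k ≤_) (sym (+-identityʳ _)) (gap X id indX)))
    ... | inj₂ es = begin
      fib (2 + k)                              ≤⟨ fib[2+k]≤fib[2+k∸1]+fib[2+k∸2] k ⟩
      fib (2 + (k ∸ 1)) + fib (2 + (k ∸ 2))    ≤⟨ +-mono-≤
        (go _ _ (IndependenceGap≥-─N[leaf] es gap) (smaller (∣X─N[z]∣<∣X∣ v∈X)))
        (go _ _ (IndependenceGap≥-─N[support] es gap) (smaller (∣X─N[z]∣<∣X∣ u∈X))) ⟩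
      misIn (X ─ N[ v ]) + misIn (X ─ N[ u ])  ≡⟨ misIn-leaf u∈X v∈X u~v leaf ⟨
      misIn X                                  ∎
      where open EndSupport es

  fib-≤-mis : ∀ {α} → IsIndependenceNumber G α → fib (n ∸ α + 2) ≤ mis G
  fib-≤-mis {α} ((S₀ , _ , ∣S₀∣≡α) , maximum) = begin
    fib (n ∸ α + 2)   ≡⟨ cong fib (+-comm (n ∸ α) 2) ⟩
    fib (2 + (n ∸ α)) ≤⟨ fib-≤-misIn ⊤ (n ∸ α) gap ⟩
    misIn ⊤           ≡⟨ mis≡misIn⊤ ⟨
    mis G             ∎
    where
    gap : IndependenceGap≥ ⊤ (n ∸ α)
    gap S _ indS = begin
      ∣ S ∣ + (n ∸ α) ≤⟨ +-monoˡ-≤ (n ∸ α) (maximum S indS) ⟩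
      α + (n ∸ α)     ≡⟨ m+[n∸m]≡n (subst (_≤ n) ∣S₀∣≡α (∣p∣≤n S₀)) ⟩
      n               ≡⟨ ∣⊤∣≡n n ⟨
      ∣ ⊤ {n} ∣       ∎

-- Combs

double : ℕ → ℕ
double zero    = zero
double (suc j) = suc (suc (double j))

k≤double : ∀ k → k ≤ double k
k≤double zero    = z≤n
k≤double (suc k) = s≤s (m≤n⇒m≤1+n (k≤double k))

double-mono-≤ : ∀ {j k} → j ≤ k → double j ≤ double k
double-mono-≤ z≤n       = z≤n
double-mono-≤ (s≤s j≤k) = s≤s (s≤s (double-mono-≤ j≤k))

double≡+ : ∀ k → double k ≡ k + k
double≡+ zero    = refl
double≡+ (suc k) = cong suc (trans (cong suc (double≡+ k)) (sym (+-suc k k)))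

-- child k a b: in the comb with k teeth, b hangs below a.  The spine is
-- 0 — 2 — ⋯ — 2k−2, the tooth 2j+1 hangs at 2j, and the vertices ≥ 2k are isolated.
child : ℕ → ℕ → ℕ → Bool
child (suc k)       zero          (suc zero)       = true
child (suc (suc k)) zero          (suc (suc zero)) = true
child (suc k)       (suc (suc a)) (suc (suc b))    = child k a b
child _             _             _                = false

child⇒< : ∀ k a b → child k a b ≡ true → a < b × b < double k
child⇒< (suc k)       zero          (suc zero)       _ = s≤s z≤n , s≤s (s≤s z≤n)
child⇒< (suc (suc k)) zero          (suc (suc zero)) _ = s≤s z≤n , s≤s (s≤s (s≤s z≤n))
child⇒< (suc k)       (suc (suc a)) (suc (suc b))    c with child⇒< k a b c
... | a<b , b<2k = s≤s (s≤s a<b) , s≤s (s≤s b<2k)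
child⇒< (suc zero)    zero          (suc (suc zero))        ()
child⇒< (suc k)       zero          zero                    ()
child⇒< (suc zero)    zero          (suc (suc (suc b)))     ()
child⇒< (suc (suc k)) zero          (suc (suc (suc b)))     ()
child⇒< (suc k)       (suc zero)    b                       ()
child⇒< (suc k)       (suc (suc a)) zero                    ()
child⇒< (suc k)       (suc (suc a)) (suc zero)              ()

child-irrefl : ∀ k a → child k a a ≡ false
child-irrefl k a = ¬-not λ c → <-irrefl refl (proj₁ (child⇒< k a a c))

child-unique : ∀ k a a′ b → child k a b ≡ true → child k a′ b ≡ true → a ≡ a′
child-unique (suc k)       zero          zero           (suc zero)       _ _  = refl
child-unique (suc (suc k)) zero          zero           (suc (suc zero)) _ _  = refl
child-unique (suc k)       (suc (suc a)) (suc (suc a′)) (suc (suc b))    c c′ = cong (λ x → suc (suc x)) (child-unique k a a′ b c c′)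
child-unique (suc (suc k)) zero          (suc (suc a′)) (suc (suc zero)) _ c′ with child⇒< (suc k) a′ zero c′
... | () , _
child-unique (suc (suc k)) (suc (suc a)) zero           (suc (suc zero)) c _  with child⇒< (suc k) a zero c
... | () , _

tooth-childless : ∀ k j b → child k (suc (double j)) b ≡ false
tooth-childless zero    j       b             = refl
tooth-childless (suc k) zero    b             = refl
tooth-childless (suc k) (suc j) zero          = refl
tooth-childless (suc k) (suc j) (suc zero)    = refl
tooth-childless (suc k) (suc j) (suc (suc b)) = tooth-childless k j b

tooth-parent : ∀ k j a → child k a (suc (double j)) ≡ true → a ≡ double j
tooth-parent (suc k)       zero    zero          _ = refl
tooth-parent (suc k)       (suc j) (suc (suc a)) c = cong (λ x → suc (suc x)) (tooth-parent k j a c)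
tooth-parent (suc zero)    (suc j) zero          ()
tooth-parent (suc (suc k)) (suc j) zero          ()
tooth-parent (suc k)       (suc j) (suc zero)    ()
tooth-parent (suc k)       zero    (suc zero)    ()
tooth-parent (suc k)       zero    (suc (suc a)) ()

tooth-edge : ∀ k j → j < k → child k (double j) (suc (double j)) ≡ true
tooth-edge (suc k) zero    _         = refl
tooth-edge (suc k) (suc j) (s≤s j<k) = tooth-edge k j j<k

spine-edge : ∀ k j → suc j < k → child k (double j) (suc (suc (double j))) ≡ true
spine-edge (suc (suc k)) zero    _         = refl
spine-edge (suc k)       (suc j) (s≤s j<k) = spine-edge k j j<k

spine-children : ∀ k j b → child k (double j) b ≡ true → b ≡ suc (double j) ⊎ (b ≡ suc (suc (double j)) × suc j < k)
spine-children (suc k)       zero    (suc zero)       _ = inj₁ refl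
spine-children (suc (suc k)) zero    (suc (suc zero)) _ = inj₂ (refl , s≤s (s≤s z≤n))
spine-children (suc k)       (suc j) (suc (suc b))    c with spine-children k j b c
... | inj₁ refl         = inj₁ refl
... | inj₂ (refl , j<k) = inj₂ (refl , s≤s j<k)

comb-adj : ℕ → ℕ → ℕ → Bool
comb-adj k a b = child k a b ∨ child k b a

comb-adj-child : ∀ k a b → child k a b ≡ true → comb-adj k a b ≡ true
comb-adj-child k a b c = cong (_∨ child k b a) c

comb-adj-parent : ∀ k a b → child k a b ≡ true → comb-adj k b a ≡ true
comb-adj-parent k a b c = trans (cong (child k b a ∨_) c) (∨-zeroʳ _)

comb-adj-downward : ∀ k a b → comb-adj k a b ≡ true → b < a → child k b a ≡ true
comb-adj-downward k a b adj b<a with child k a b in c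
... | true  = contradiction (proj₁ (child⇒< k a b c)) (<⇒≯ b<a)
... | false = adj

comb-adj-tooth : ∀ k j b → comb-adj k (suc (double j)) b ≡ true → b ≡ double j
comb-adj-tooth k j b adj with child k b (suc (double j)) in c
... | true  = tooth-parent k j b c
... | false = ⊥-elim (not-¬ adj (cong (_∨ false) (tooth-childless k j b)))

comb-adj-spine : ∀ k j b → double j ≤ b → comb-adj k (double j) b ≡ true
  → b ≡ suc (double j) ⊎ (b ≡ suc (suc (double j)) × suc j < k)
comb-adj-spine k j b 2j≤b adj with child k (double j) b in c
... | true  = spine-children k j b c
... | false with child k b (double j) in c′
...   | true  = contradiction 2j≤b (<⇒≱ (proj₁ (child⇒< k b (double j) c′)))

comb-adj-isolated : ∀ k a b → double k ≤ a → comb-adj k a b ≡ false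
comb-adj-isolated k a b 2k≤a = cong₂ _∨_
  (¬-not λ c → <⇒≱ (<-trans (proj₁ (child⇒< k a b c)) (proj₂ (child⇒< k a b c))) 2k≤a)
  (¬-not λ c → <⇒≱ (proj₂ (child⇒< k b a c)) 2k≤a)

Comb : ∀ n → ℕ → Graph n
Comb n k = record
  { Adj    = λ x y → comb-adj k (toℕ x) (toℕ y)
  ; sym    = λ x y → ∨-comm (child k (toℕ x) (toℕ y)) (child k (toℕ y) (toℕ x))
  ; irrefl = λ x → cong₂ _∨_ (child-irrefl k (toℕ x)) (child-irrefl k (toℕ x))
  }

Comb-forest : ∀ n k → Forest (Comb n k)
Comb-forest n k = lowerNeighbour-unique⇒forest (Comb n k) λ x y y′ x~y x~y′ y<x y′<x →
  toℕ-injective (child-unique k _ _ (toℕ x) (comb-adj-downward k _ _ x~y y<x) (comb-adj-downward k _ _ x~y′ y′<x))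

-- Only meaningful when 2k ≤ n.
teethAndIsolated : ∀ n → ℕ → Subset n
teethAndIsolated n             zero    = ⊤
teethAndIsolated (suc (suc n)) (suc k) = outside ∷ inside ∷ teethAndIsolated n k
teethAndIsolated _             (suc k) = ⊤

∣teethAndIsolated∣ : ∀ n k → double k ≤ n → ∣ teethAndIsolated n k ∣ ≡ n ∸ k
∣teethAndIsolated∣ n             zero    _                = ∣⊤∣≡n n
∣teethAndIsolated∣ (suc (suc n)) (suc k) (s≤s (s≤s 2k≤n)) =
  trans (cong suc (∣teethAndIsolated∣ n k 2k≤n)) (sym (+-∸-assoc 1 (≤-trans (k≤double k) 2k≤n)))

teethAndIsolated-independent : ∀ n k → double k ≤ n → Independent (Comb n k) (teethAndIsolated n k)
teethAndIsolated-independent n             zero    _                _ _ _ _ = refl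
teethAndIsolated-independent (suc (suc n)) (suc k) (s≤s (s≤s 2k≤n)) = independent
  where
  independent : Independent (Comb (suc (suc n)) (suc k)) (teethAndIsolated (suc (suc n)) (suc k))
  independent (fsuc fzero)    (fsuc fzero)    _                  _                  = Adj-irrefl (Comb (suc (suc n)) (suc k)) (fsuc fzero)
  independent (fsuc fzero)    (fsuc (fsuc y)) _                  _                  = refl
  independent (fsuc (fsuc x)) (fsuc fzero)    _                  _                  = refl
  independent (fsuc (fsuc x)) (fsuc (fsuc y)) (there (there x∈)) (there (there y∈)) =
    teethAndIsolated-independent n k 2k≤n x y x∈ y∈

-- An independent set contains at most one vertex of each pair {2j, 2j+1}.
Comb-∣independent∣≤ : ∀ n k → double k ≤ n → ∀ S → Independent (Comb n k) S → ∣ S ∣ ≤ n ∸ k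
Comb-∣independent∣≤ n             zero    _                S           _   = ∣p∣≤n S
Comb-∣independent∣≤ (suc (suc n)) (suc k) (s≤s (s≤s 2k≤n)) (s ∷ t ∷ S) ind = begin
  ∣ s ∷ t ∷ S ∣ ≤⟨ pair≤1 s t (λ { refl refl → not-¬ refl (ind fzero (fsuc fzero) here (there here)) }) ⟩
  suc ∣ S ∣     ≤⟨ s≤s (Comb-∣independent∣≤ n k 2k≤n S λ x y x∈ y∈ →
                     ind (fsuc (fsuc x)) (fsuc (fsuc y)) (there (there x∈)) (there (there y∈))) ⟩
  suc (n ∸ k)   ≡⟨ +-∸-assoc 1 (≤-trans (k≤double k) 2k≤n) ⟨
  suc n ∸ k     ∎
  where
  open ≤-Reasoning
  pair≤1 : ∀ s t → (s ≡ inside → t ≡ inside → ⊥) → ∣ s ∷ t ∷ S ∣ ≤ suc ∣ S ∣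
  pair≤1 inside  inside  both = ⊥-elim (both refl refl)
  pair≤1 inside  outside _    = ≤-refl
  pair≤1 outside inside  _    = ≤-refl
  pair≤1 outside outside _    = n≤1+n _

Comb-α : ∀ n k → double k ≤ n → IsIndependenceNumber (Comb n k) (n ∸ k)
Comb-α n k 2k≤n =
  (teethAndIsolated n k , teethAndIsolated-independent n k 2k≤n , ∣teethAndIsolated∣ n k 2k≤n) , Comb-∣independent∣≤ n k 2k≤n

module CombMis (n k : ℕ) (2k≤n : double k ≤ n) where

  open MaximalIndependentSets (Comb n k)
  open ≡-Reasoning

  vertex : ∀ c → c < double k → Fin n
  vertex c c<2k = fromℕ< (<-≤-trans c<2k 2k≤n)

  toℕ-vertex : ∀ {c} (c<2k : c < double k) → toℕ (vertex c c<2k) ≡ c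
  toℕ-vertex c<2k = toℕ-fromℕ< (<-≤-trans c<2k 2k≤n)

  Adj-vertex : ∀ {c} (c<2k : c < double k) x → Adj (Comb n k) (vertex c c<2k) x ≡ comb-adj k c (toℕ x)
  Adj-vertex c<2k x = cong (λ a → comb-adj k a (toℕ x)) (toℕ-vertex c<2k)

  ∈N[vertex] : ∀ {c} (c<2k : c < double k) {x} → toℕ x ≡ c ⊎ comb-adj k c (toℕ x) ≡ true → x ∈ N[ vertex c c<2k ]
  ∈N[vertex] c<2k     (inj₁ x≡c) = subst (_∈ N[ vertex _ c<2k ]) (toℕ-injective (trans (toℕ-vertex c<2k) (sym x≡c))) (z∈N[z] _)
  ∈N[vertex] c<2k {x} (inj₂ adj) = adj⇒∈N[] (trans (Adj-vertex c<2k x) adj)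

  ∉N[vertex] : ∀ {c} (c<2k : c < double k) {x} → toℕ x ≢ c → comb-adj k c (toℕ x) ≡ false → x ∉ N[ vertex c c<2k ]
  ∉N[vertex] c<2k {x} x≢c nonadj x∈ with ∈N[]⇒≡⊎adj x∈
  ... | inj₁ refl = x≢c (toℕ-vertex c<2k)
  ... | inj₂ adj  = not-¬ (trans (sym (Adj-vertex c<2k x)) adj) nonadj

  private
    ≤∧≡∧<⇒⊥ : ∀ {a b c} → c ≤ a → a ≡ b → b < c → ⊥
    ≤∧≡∧<⇒⊥ c≤a refl b<c = <⇒≱ b<c c≤a

  module Tooth (j : ℕ) (j<k : j < k) where

    2j+1<2k : suc (double j) < double k
    2j+1<2k = double-mono-≤ j<k

    2j<2k : double j < double k
    2j<2k = ≤-trans (n≤1+n _) 2j+1<2k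

    X X′ : Subset n
    X  = indicesFrom (double j)
    X′ = indicesFrom (suc (double j))

    u v : Fin n
    u = vertex (double j) 2j<2k
    v = vertex (suc (double j)) 2j+1<2k

    u∈X : u ∈ X
    u∈X = ∈indicesFrom⁺ (≤-reflexive (sym (toℕ-vertex 2j<2k)))

    v∈X : v ∈ X
    v∈X = ∈indicesFrom⁺ (subst (double j ≤_) (sym (toℕ-vertex 2j+1<2k)) (n≤1+n _))

    v∈X′ : v ∈ X′
    v∈X′ = ∈indicesFrom⁺ (≤-reflexive (sym (toℕ-vertex 2j+1<2k)))

    u~v : Adj (Comb n k) u v ≡ true
    u~v = trans (Adj-vertex 2j<2k v) (subst (λ b → comb-adj k (double j) b ≡ true) (sym (toℕ-vertex 2j+1<2k))
      (comb-adj-child k _ _ (tooth-edge k j j<k)))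

    v-leaf : LeafIn X v u
    v-leaf y _ v~y =
      toℕ-injective (trans (comb-adj-tooth k j (toℕ y) (trans (sym (Adj-vertex 2j+1<2k y)) v~y)) (sym (toℕ-vertex 2j<2k)))

    v-isolated : ∀ y → y ∈ X′ → Adj (Comb n k) v y ≡ false
    v-isolated y y∈ = ¬-not λ v~y →
      ≤∧≡∧<⇒⊥ (∈indicesFrom⁻ y∈) (comb-adj-tooth k j (toℕ y) (trans (sym (Adj-vertex 2j+1<2k y)) v~y)) ≤-refl

    private
      v-far : ∀ {x} → 2 + double j ≤ toℕ x → x ∉ N[ v ]
      v-far {x} le = ∉N[vertex] 2j+1<2k (λ e → ≤∧≡∧<⇒⊥ le e ≤-refl)
        (¬-not λ adj → ≤∧≡∧<⇒⊥ le (comb-adj-tooth k j (toℕ x) adj) (n≤1+n _))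

    X─N[v] : X ─ N[ v ] ≡ indicesFrom (2 + double j)
    X─N[v] = indicesFrom-─N[] 2 near v-far
      where
      near : ∀ {x} d → d < 2 → toℕ x ≡ d + double j → x ∈ N[ v ]
      near zero          _ x≡ = ∈N[vertex] 2j+1<2k (inj₂ (subst (λ a → comb-adj k (suc (double j)) a ≡ true) (sym x≡)
        (comb-adj-parent k _ _ (tooth-edge k j j<k))))
      near (suc zero)    _ x≡ = ∈N[vertex] 2j+1<2k (inj₁ x≡)
      near (suc (suc d)) (s≤s (s≤s ()))

    X′─N[v] : X′ ─ N[ v ] ≡ indicesFrom (2 + double j)
    X′─N[v] = indicesFrom-─N[] 1 near v-far
      where
      near : ∀ {x} d → d < 1 → toℕ x ≡ d + suc (double j) → x ∈ N[ v ]
      near zero    _ x≡ = ∈N[vertex] 2j+1<2k (inj₁ x≡)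
      near (suc d) (s≤s ())

    private
      u-near : ∀ {x} d → d < 2 → toℕ x ≡ d + double j → x ∈ N[ u ]
      u-near zero          _ x≡ = ∈N[vertex] 2j<2k (inj₁ x≡)
      u-near (suc zero)    _ x≡ = ∈N[vertex] 2j<2k (inj₂ (subst (λ a → comb-adj k (double j) a ≡ true) (sym x≡)
        (comb-adj-child k _ _ (tooth-edge k j j<k))))
      u-near (suc (suc d)) (s≤s (s≤s ()))

      u-far : ∀ {x : Fin n} → 2 + double j ≤ toℕ x → comb-adj k (double j) (toℕ x) ≡ true
        → toℕ x ≡ 2 + double j × suc j < k
      u-far {x} le adj with comb-adj-spine k j (toℕ x) (≤-trans (≤-trans (n≤1+n _) (n≤1+n _)) le) adj
      ... | inj₁ x≡ = ⊥-elim (≤∧≡∧<⇒⊥ le x≡ ≤-refl)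
      ... | inj₂ r  = r

    X─N[u]-last : suc j ≡ k → X ─ N[ u ] ≡ indicesFrom (2 + double j)
    X─N[u]-last 1+j≡k = indicesFrom-─N[] 2 u-near far
      where
      far : ∀ {x} → 2 + double j ≤ toℕ x → x ∉ N[ u ]
      far {x} le = ∉N[vertex] 2j<2k (λ e → ≤∧≡∧<⇒⊥ le e (n≤1+n _))
        (¬-not λ adj → <-irrefl 1+j≡k (proj₂ (u-far le adj)))

    X─N[u] : suc j < k → X ─ N[ u ] ≡ indicesFrom (3 + double j)
    X─N[u] 1+j<k = indicesFrom-─N[] 3 near far
      where
      near : ∀ {x} d → d < 3 → toℕ x ≡ d + double j → x ∈ N[ u ]
      near zero             _ x≡ = u-near zero (s≤s z≤n) x≡
      near (suc zero)       _ x≡ = u-near (suc zero) (s≤s (s≤s z≤n)) x≡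
      near (suc (suc zero)) _ x≡ = ∈N[vertex] 2j<2k (inj₂ (subst (λ a → comb-adj k (double j) a ≡ true) (sym x≡)
        (comb-adj-child k _ _ (spine-edge k j 1+j<k))))
      near (suc (suc (suc d))) (s≤s (s≤s (s≤s ())))
      far : ∀ {x} → 3 + double j ≤ toℕ x → x ∉ N[ u ]
      far {x} le = ∉N[vertex] 2j<2k (λ e → ≤∧≡∧<⇒⊥ le e (≤-trans (n≤1+n _) (n≤1+n _)))
        (¬-not λ adj → ≤∧≡∧<⇒⊥ le (proj₁ (u-far (≤-trans (n≤1+n _) le) adj)) ≤-refl)

  isolated-independent : Independent (Comb n k) (indicesFrom (double k))
  isolated-independent x y x∈ _ = comb-adj-isolated k (toℕ x) (toℕ y) (∈indicesFrom⁻ x∈)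

  -- Split at the first remaining tooth: removing N[2j+1] leaves the vertices ≥ 2j+2, and
  -- removing N[2j] leaves those ≥ 2j+3, of which 2j+3 is isolated.
  misIn-indicesFrom : ∀ d j → j + d ≡ k → misIn (indicesFrom (double j)) ≡ fib (2 + d)
  misIn-indicesFrom zero j j+0≡k rewrite trans (sym (+-identityʳ j)) j+0≡k = misIn-independent isolated-independent
  misIn-indicesFrom (suc zero) j j+1≡k = begin
    misIn (indicesFrom (double j))
      ≡⟨ misIn-leaf u∈X v∈X u~v v-leaf ⟩
    misIn (indicesFrom (double j) ─ N[ v ]) + misIn (indicesFrom (double j) ─ N[ u ])
      ≡⟨ cong₂ (λ A B → misIn A + misIn B) X─N[v] (X─N[u]-last 1+j≡k) ⟩
    misIn (indicesFrom (2 + double j)) + misIn (indicesFrom (2 + double j))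
      ≡⟨ cong₂ _+_ one one ⟩
    fib 3
      ∎
    where
    1+j≡k : suc j ≡ k
    1+j≡k = trans (cong suc (sym (+-identityʳ j))) (trans (sym (+-suc j 0)) j+1≡k)
    open Tooth j (≤-reflexive 1+j≡k)
    one = misIn-indicesFrom zero (suc j) (trans (+-identityʳ (suc j)) 1+j≡k)
  misIn-indicesFrom (suc (suc d)) j j+2+d≡k = begin
    misIn (indicesFrom (double j))
      ≡⟨ misIn-leaf u∈X v∈X u~v v-leaf ⟩
    misIn (indicesFrom (double j) ─ N[ v ]) + misIn (indicesFrom (double j) ─ N[ u ])
      ≡⟨ cong₂ (λ A B → misIn A + misIn B) X─N[v] (X─N[u] 1+j<k) ⟩
    misIn (indicesFrom (2 + double j)) + misIn (indicesFrom (3 + double j))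
      ≡⟨ cong (misIn (indicesFrom (2 + double j)) +_) (misIn-isolated next.v∈X′ next.v-isolated) ⟩
    misIn (indicesFrom (2 + double j)) + misIn (indicesFrom (3 + double j) ─ N[ next.v ])
      ≡⟨ cong (λ A → misIn (indicesFrom (2 + double j)) + misIn A) next.X′─N[v] ⟩
    misIn (indicesFrom (2 + double j)) + misIn (indicesFrom (4 + double j))
      ≡⟨ cong₂ _+_ (misIn-indicesFrom (suc d) (suc j) j+1+1+d≡k) (misIn-indicesFrom d (suc (suc j)) j+2+d≡k′) ⟩
    fib (3 + d) + fib (2 + d)
      ∎
    where
    j+1+1+d≡k = trans (sym (+-suc j (suc d))) j+2+d≡k
    j+2+d≡k′  = trans (cong suc (sym (+-suc j d))) j+1+1+d≡k
    1+j<k : suc j < k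
    1+j<k = subst (suc (suc j) ≤_) j+2+d≡k
      (≤-trans (s≤s (s≤s (m≤m+n j d))) (≤-reflexive (sym (trans (+-suc j (suc d)) (cong suc (+-suc j d))))))
    open Tooth j (≤-trans (n≤1+n _) 1+j<k)
    module next = Tooth (suc j) 1+j<k

  mis-Comb : mis (Comb n k) ≡ fib (2 + k)
  mis-Comb = begin
    mis (Comb n k)                 ≡⟨ mis≡misIn⊤ ⟩
    misIn ⊤                        ≡⟨ cong misIn (⊆-antisym (λ _ → ∈indicesFrom⁺ z≤n) ⊆⊤) ⟩
    misIn (indicesFrom (double 0)) ≡⟨ misIn-indicesFrom k 0 refl ⟩
    fib (2 + k)                    ∎

extremalForest : ∀ n α → ⌈ n /2⌉ ≤ α → α ≤ n
  → Σ (Graph n) λ F → Forest F × IsIndependenceNumber F α × mis F ≡ fib (n ∸ α + 2)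
extremalForest n α ⌈n/2⌉≤α α≤n =
  Comb n k , Comb-forest n k , subst (IsIndependenceNumber (Comb n k)) (m∸[m∸n]≡n α≤n) (Comb-α n k 2k≤n) ,
  trans (CombMis.mis-Comb n k 2k≤n) (cong fib (+-comm 2 k))
  where
  open ≤-Reasoning
  k = n ∸ α
  n≤α+α : n ≤ α + α
  n≤α+α = begin
    n                 ≡⟨ ⌊n/2⌋+⌈n/2⌉≡n n ⟨
    ⌊ n /2⌋ + ⌈ n /2⌉ ≤⟨ +-mono-≤ (≤-trans (⌊n/2⌋≤⌈n/2⌉ n) ⌈n/2⌉≤α) ⌈n/2⌉≤α ⟩
    α + α             ∎
  2k≤n : double k ≤ n
  2k≤n = begin
    double k  ≡⟨ double≡+ k ⟩
    k + k     ≤⟨ +-monoʳ-≤ k (≤-trans (∸-monoˡ-≤ α n≤α+α) (≤-reflexive (m+n∸n≡m α α))) ⟩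
    k + α     ≡⟨ m∸n+n≡m α≤n ⟩
    n         ∎

corollary1 : ((n : ℕ) (F : Graph n) (α : ℕ) → Forest F → IsIndependenceNumber F α → fib (n ∸ α + 2) ≤ mis F)
    × ((n α : ℕ) → 2 ≤ n → ⌈ n /2⌉ ≤ α → α ≤ n ∸ 1 → Σ (Graph n) λ F → Forest F × IsIndependenceNumber F α × mis F ≡ fib (n ∸ α + 2))
corollary1 = (λ n F α forest → LowerBound.fib-≤-mis F forest)
           , (λ n α _ ⌈n/2⌉≤α α≤n-1 → extremalForest n α ⌈n/2⌉≤α (≤-trans α≤n-1 (m∸n≤m n 1)))
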